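{- The identity operator respects $P$. Equivalently, for every $\pi\in\mathrm{Av}(231)$, $\mathrm{T}_{\mathrm{in}}(P(\pi))=\lambda_\pi(\mathrm{T}_{\mathrm{in}}(\pi))$ (the remaining conditions being immediate for the identity).
   Context: Notation and conventions. - Permutations of $[n]$ are in one-line notation, with composition $(\lambda\circ\sigma)(i)=\lambda(\sigma(i))$. - $\mathrm{Av}(231)$ (resp. $\mathrm{Av}(132)$) is the set of permutations avoiding $231$ (resp. $132$). The bijection $P$. - $\alpha\oplus\beta=\alpha(\beta+|\alpha|)$ and $\alpha\ominus\beta=(\alpha+|\beta|)\beta$. - $P:\mathrm{Av}(231)\to\mathrm{Av}(132)$ is defined by $P(\varepsilon)=\varepsilon$ and $P(\alpha\oplus(1\ominus\beta))=(P(\alpha)\oplus1)\ominus P(\beta)$, using the unique decomposition of nonempty $231$-avoiders as $\alpha\oplus(1\ominus\beta)$ with $\alpha,\beta\in\mathrm{Av}(231)$. - For $\pi\in\mathrm{Av}(231)$ of size $n$, $\lambda_\pi$ is the permutation of $[n]$ with $P(\pi)=\lambda_\pi\circ\pi$. Trees. - A binary tree is decreasing if every child's label is smaller than its parent's. - The in-order reading is (left subtree reading)(root)(right subtree reading). - $\mathrm{T}_{\mathrm{in}}(\pi)$ is the unique decreasing binary tree with in-order reading $\pi$. - $\lambda(T)$ relabels each label $\ell$ of $T$ by $\lambda(\ell)$. Respecting $P$. An operator $\mathbf{A}$ on permutations respects $P$ if, for every $n$ and every $\pi\in\mathrm{Av}(231)$ of size $n$ in the image of $\mathbf{A}$: -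 (i) every $\theta$ with $\mathbf{A}(\theta)=\pi$ satisfies $\mathbf{A}(\lambda_\pi\circ\theta)=P(\pi)$ and $\mathrm{T}_{\mathrm{in}}(\lambda_\pi\circ\theta)=\lambda_\pi(\mathrm{T}_{\mathrm{in}}(\theta))$; - (ii) $\theta\mapsto\lambda_\pi\circ\theta$ is a bijection from $\mathbf{A}^{ -1}(\pi)$ onto $\mathbf{A}^{ -1}(P(\pi))$. -}

module Defs where

open import Data.Nat using (ℕ; zero; suc; _+_; _∸_; _<_; _≟_)
open import Data.List using (List; []; _∷_; _++_; map; length; upTo)
open import Data.List.Relation.Binary.Sublist.Propositional using (_⊆_)
open import Data.List.Relation.Binary.Permutation.Propositional using (_↭_)
open import Data.Product using (_×_; _,_)
open import Data.Unit using (⊤)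
open import Relation.Nullary using (¬_; yes; no)
open import Relation.Binary.PropositionalEquality using (_≡_)

-- Permutations in one-line notation: lists of values 1..n.
range : ℕ → List ℕ
range n = map suc (upTo n)

IsPerm : ℕ → List ℕ → Set
IsPerm n π = π ↭ range n

Avoids231 : List ℕ → Set
Avoids231 π = ∀ a b c → (a ∷ b ∷ c ∷ []) ⊆ π → ¬ (c < a × a < b)

_⊕_ : List ℕ → List ℕ → List ℕ
α ⊕ β = α ++ map (_+ length α) β

_⊖_ : List ℕ → List ℕ → List ℕ
α ⊖ β = map (_+ length β) α ++ β

splitAtVal : ℕ → List ℕ → List ℕ × List ℕ
splitAtVal v [] = [] , []
splitAtVal v (x ∷ xs) with x ≟ v
... | yes _ = [] , xs
... | no _ with splitAtVal v xs
...   | (l , r) = x ∷ l , r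

-- P with fuel. A nonempty 231-avoider π of size n is α ⊕ (1 ⊖ β):
-- α is the prefix before the entry n, and the suffix after n is β + |α|.
Pfuel : ℕ → List ℕ → List ℕ
Pfuel zero _ = []
Pfuel (suc k) [] = []
Pfuel (suc k) π@(_ ∷ _) with splitAtVal (length π) π
... | (α , β′) = (Pfuel k α ⊕ (1 ∷ [])) ⊖ Pfuel k (map (_∸ length α) β′)

P : List ℕ → List ℕ
P π = Pfuel (length π) π

nth : List ℕ → ℕ → ℕ
nth [] _ = 0
nth (x ∷ xs) zero = x
nth (x ∷ xs) (suc i) = nth xs i

app : List ℕ → ℕ → ℕ
app λ′ v = nth λ′ (v ∸ 1)

_∘ₚ_ : List ℕ → List ℕ → List ℕ
λ′ ∘ₚ σ = map (app λ′) σ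

data Tree : Set where
  leaf : Tree
  node : Tree → ℕ → Tree → Tree

RootBelow : ℕ → Tree → Set
RootBelow v leaf = ⊤
RootBelow v (node _ x _) = x < v

Decreasing : Tree → Set
Decreasing leaf = ⊤
Decreasing (node l x r) = RootBelow x l × RootBelow x r × Decreasing l × Decreasing r

inorder : Tree → List ℕ
inorder leaf = []
inorder (node l x r) = inorder l ++ (x ∷ inorder r)

-- T is T_in(π): the (unique) decreasing binary tree with in-order reading π
IsTin : List ℕ → Tree → Set
IsTin π T = Decreasing T × inorder T ≡ π

relabel : List ℕ → Tree → Tree
relabel λ′ leaf = leaf
relabel λ′ (node l x r) = node (relabel λ′ l) (app λ′ x) (relabel λ′ r)

-- Write π = α ⊕ (1 ⊖ β). Its decreasing tree has root n, left subtree T_in(α) and right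
-- subtree T_in(β) shifted by |α|, and P π = (P α ⊕ 1) ⊖ P β has n at the same position,
-- P α + |β| to its left and P β to its right. So P is read off the shape of T_in(π)
-- alone, as the in-order reading of a tree Ptree T_in(π) that is decreasing by construction;
-- two trees of the same shape with the same reading coincide, so λ_π(T_in(π)) = Ptree T_in(π).
module Submission where

open import Defs
open import Data.Nat using (ℕ; zero; suc; _+_; _∸_; _≤_; _<_; s≤s; s≤s⁻¹; z<s; _≟_)
open import Data.Nat.Properties
open import Data.List using (List; []; _∷_; _++_; map; length; applyUpTo; [_])
open import Data.List.Properties
  using (map-++; map-∘; map-cong; map-id; map-upTo; ++-assoc; ++-identityʳ; ∷-injective;
         length-map; length-++; length-applyUpTo; applyUpTo-∷ʳ)
open import Data.List.Membership.Propositional using (_∈_)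
open import Data.List.Membership.Propositional.Properties
  using (∈-map⁻; ∈-++⁺ˡ; ∈-++⁺ʳ; ∈-++⁻; ∈-∃++; ∈-applyUpTo⁻)
open import Data.List.Relation.Unary.Any using (here; there)
import Data.List.Relation.Unary.All as All
import Data.List.Relation.Unary.All.Properties as All
open import Data.List.Relation.Unary.AllPairs using ([]; _∷_)
open import Data.List.Relation.Unary.Unique.Propositional using (Unique)
import Data.List.Relation.Unary.Unique.Propositional.Properties as Unique
open import Data.List.Relation.Binary.Permutation.Propositional using (_↭_; ↭-sym; ↭-trans; ↭⇒↭ₛ)
import Data.List.Relation.Binary.Permutation.Propositional.Properties as Perm
import Data.List.Relation.Binary.Permutation.Setoid.Properties as Permₛ
open import Data.List.Relation.Binary.Sublist.Propositional using (_∷_; _∷ʳ_; from∈)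
import Data.List.Relation.Binary.Sublist.Propositional.Properties as Sublist
open import Data.Product using (_×_; _,_; proj₁; proj₂)
open import Data.Sum using (inj₁; inj₂)
open import Data.Empty using (⊥-elim)
open import Data.Unit using (⊤; tt)
open import Function using (_∘_)
open import Relation.Nullary using (yes; no)
open import Relation.Binary.Core using (_Preserves_⟶_)
open import Relation.Binary.PropositionalEquality hiding ([_])

mapT : (ℕ → ℕ) → Tree → Tree
mapT f leaf = leaf
mapT f (node l x r) = node (mapT f l) (f x) (mapT f r)

size : Tree → ℕ
size leaf = zero
size (node l x r) = suc (size l + size r)

relabel≡mapT : ∀ λ′ T → relabel λ′ T ≡ mapT (app λ′) T
relabel≡mapT λ′ leaf = refl
relabel≡mapT λ′ (node l x r) =
  cong₂ (λ l′ r′ → node l′ (app λ′ x) r′) (relabel≡mapT λ′ l) (relabel≡mapT λ′ r)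

inorder-mapT : ∀ f T → inorder (mapT f T) ≡ map f (inorder T)
inorder-mapT f leaf = refl
inorder-mapT f (node l x r) = begin
  inorder (mapT f l) ++ f x ∷ inorder (mapT f r)
    ≡⟨ cong₂ (λ L R → L ++ f x ∷ R) (inorder-mapT f l) (inorder-mapT f r) ⟩
  map f (inorder l) ++ map f (x ∷ inorder r)
    ≡⟨ map-++ f (inorder l) (x ∷ inorder r) ⟨
  map f (inorder (node l x r)) ∎
  where open ≡-Reasoning

length-inorder : ∀ T → length (inorder T) ≡ size T
length-inorder leaf = refl
length-inorder (node l x r) = begin
  length (inorder l ++ x ∷ inorder r)             ≡⟨ length-++ (inorder l) ⟩
  length (inorder l) + suc (length (inorder r))   ≡⟨ +-suc _ _ ⟩
  suc (length (inorder l) + length (inorder r))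
    ≡⟨ cong₂ (λ a b → suc (a + b)) (length-inorder l) (length-inorder r) ⟩
  size (node l x r) ∎
  where open ≡-Reasoning

data SameShape : Tree → Tree → Set where
  leaf : SameShape leaf leaf
  node : ∀ {l l′ x x′ r r′} → SameShape l l′ → SameShape r r′ →
         SameShape (node l x r) (node l′ x′ r′)

SameShape-refl : ∀ T → SameShape T T
SameShape-refl leaf = leaf
SameShape-refl (node l x r) = node (SameShape-refl l) (SameShape-refl r)

SameShape-mapT : ∀ f {S T} → SameShape S T → SameShape (mapT f S) T
SameShape-mapT f leaf = leaf
SameShape-mapT f (node sl sr) = node (SameShape-mapT f sl) (SameShape-mapT f sr)

length-inorder-SameShape : ∀ {S T} → SameShape S T → length (inorder S) ≡ size T
length-inorder-SameShape {S} {T} s = trans (length-inorder S) (sizes s)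
  where
  sizes : ∀ {S T} → SameShape S T → size S ≡ size T
  sizes leaf = refl
  sizes (node sl sr) = cong₂ (λ a b → suc (a + b)) (sizes sl) (sizes sr)

++-injective : ∀ (ws xs : List ℕ) {ys zs} → length ws ≡ length xs →
               ws ++ ys ≡ xs ++ zs → ws ≡ xs × ys ≡ zs
++-injective []       []       _   eq = refl , eq
++-injective (w ∷ ws) (x ∷ xs) len eq with ∷-injective eq
... | refl , eq′ with ++-injective ws xs (suc-injective len) eq′
...   | refl , eq″ = refl , eq″

inorder-injective : ∀ {S T U} → SameShape S U → SameShape T U → inorder S ≡ inorder T → S ≡ T
inorder-injective leaf leaf _ = refl
inorder-injective {node l₁ x₁ r₁} {node l₂ x₂ r₂} (node sl sr) (node tl tr) eq
  with ++-injective (inorder l₁) (inorder l₂)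
         (trans (length-inorder-SameShape sl) (sym (length-inorder-SameShape tl))) eq
... | eqˡ , eqʳ with ∷-injective eqʳ
...   | refl , eqʳ′
  rewrite inorder-injective sl tl eqˡ | inorder-injective sr tr eqʳ′ = refl

RootBelow-mapT : ∀ {f} → f Preserves _<_ ⟶ _<_ →
                 ∀ {v} T → RootBelow v T → RootBelow (f v) (mapT f T)
RootBelow-mapT mono leaf _ = tt
RootBelow-mapT mono (node _ _ _) x<v = mono x<v

Decreasing-mapT : ∀ {f} → f Preserves _<_ ⟶ _<_ → ∀ T → Decreasing T → Decreasing (mapT f T)
Decreasing-mapT mono leaf _ = tt
Decreasing-mapT mono (node l x r) (rl , rr , dl , dr) =
  RootBelow-mapT mono l rl , RootBelow-mapT mono r rr ,
  Decreasing-mapT mono l dl , Decreasing-mapT mono r dr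

inorder-< : ∀ T {u v} → Decreasing T → RootBelow v T → u ∈ inorder T → u < v
inorder-< (node l x r) (rl , rr , dl , dr) x<v u∈ with ∈-++⁻ (inorder l) u∈
... | inj₁ u∈l         = <-trans (inorder-< l dl rl u∈l) x<v
... | inj₂ (here refl) = x<v
... | inj₂ (there u∈r) = <-trans (inorder-< r dr rr u∈r) x<v

_≪_ : List ℕ → List ℕ → Set
xs ≪ ys = ∀ {u w} → u ∈ xs → w ∈ ys → u < w

Separated : Tree → Set
Separated leaf = ⊤
Separated (node l x r) = inorder l ≪ inorder r × Separated l × Separated r

Unique-++⁻ : ∀ (xs : List ℕ) {ys} → Unique (xs ++ ys) →
             Unique xs × Unique ys × (∀ {u w} → u ∈ xs → w ∈ ys → u ≢ w)
Unique-++⁻ []       u = [] , u , λ ()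
Unique-++⁻ (x ∷ xs) {ys} (x∉ ∷ u) with Unique-++⁻ xs u
... | uxs , uys , disjoint = All.++⁻ˡ xs x∉ ∷ uxs , uys , disjoint′
  where
  disjoint′ : ∀ {u w} → u ∈ x ∷ xs → w ∈ ys → u ≢ w
  disjoint′ (here refl) w∈ = All.lookup x∉ (∈-++⁺ʳ xs w∈)
  disjoint′ (there u∈)  w∈ = disjoint u∈ w∈

-- In a decreasing tree, u ∈ l, w ∈ r and w < u would make u x w an occurrence of 231.
Avoids231⇒Separated : ∀ T → Decreasing T → Unique (inorder T) → Avoids231 (inorder T) →
                      Separated T
Avoids231⇒Separated leaf _ _ _ = tt
Avoids231⇒Separated (node l x r) (rl , rr , dl , dr) u avoids
  with Unique-++⁻ (inorder l) {x ∷ inorder r} u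
... | ul , _ ∷ ur , disjoint =
  l≪r , Avoids231⇒Separated l dl ul avoidsˡ , Avoids231⇒Separated r dr ur avoidsʳ
  where
  l≪r : inorder l ≪ inorder r
  l≪r u∈ w∈ = ≤∧≢⇒<
    (≮⇒≥ λ w<u → avoids _ x _ (Sublist.++⁺ (from∈ u∈) (refl ∷ from∈ w∈))
                            (w<u , inorder-< l dl rl u∈))
    (disjoint u∈ (there w∈))
  avoidsˡ : Avoids231 (inorder l)
  avoidsˡ a b c τ = avoids a b c (Sublist.++⁺ʳ (x ∷ inorder r) τ)
  avoidsʳ : Avoids231 (inorder r)
  avoidsʳ a b c τ = avoids a b c (Sublist.++⁺ˡ (inorder l) (x ∷ʳ τ))

interval : ℕ → ℕ → List ℕ
interval s = applyUpTo (λ i → s + suc i)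

length-interval : ∀ s n → length (interval s n) ≡ n
length-interval s = length-applyUpTo _

interval-suc : ∀ s n → interval s (suc n) ≡ interval s n ++ [ s + suc n ]
interval-suc s n = sym (applyUpTo-∷ʳ _ n)

interval-top : ∀ s n → s + suc n ∈ interval s (suc n)
interval-top s n =
  subst (s + suc n ∈_) (sym (interval-suc s n)) (∈-++⁺ʳ (interval s n) (here refl))

∈-interval⁻ : ∀ {s n v} → v ∈ interval s n → s < v × v ≤ s + n
∈-interval⁻ {s} v∈ with ∈-applyUpTo⁻ _ v∈
... | i , i<n , refl = m<m+n s z<s , +-monoʳ-≤ s i<n

Unique-interval : ∀ s n → Unique (interval s n)
Unique-interval s n =
  Unique.applyUpTo⁺₁ _ n (λ i<j _ eq → <⇒≢ i<j (suc-injective (+-cancelˡ-≡ s _ _ eq)))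

interval-+ : ∀ s a b → interval s (a + b) ≡ interval s a ++ interval (s + a) b
interval-+ s a zero =
  trans (cong (interval s) (+-identityʳ a)) (sym (++-identityʳ (interval s a)))
interval-+ s a (suc b) = begin
  interval s (a + suc b)                     ≡⟨ cong (interval s) (+-suc a b) ⟩
  interval s (suc (a + b))                   ≡⟨ interval-suc s (a + b) ⟩
  interval s (a + b) ++ [ s + suc (a + b) ]
    ≡⟨ cong (_++ [ s + suc (a + b) ]) (interval-+ s a b) ⟩
  (interval s a ++ interval (s + a) b) ++ [ s + suc (a + b) ]
    ≡⟨ ++-assoc (interval s a) _ _ ⟩
  interval s a ++ interval (s + a) b ++ [ s + suc (a + b) ]
    ≡⟨ cong (λ t → interval s a ++ interval (s + a) b ++ [ t ]) top ⟩
  interval s a ++ interval (s + a) b ++ [ s + a + suc b ]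
    ≡⟨ cong (interval s a ++_) (interval-suc (s + a) b) ⟨
  interval s a ++ interval (s + a) (suc b) ∎
  where
  open ≡-Reasoning
  top : s + suc (a + b) ≡ s + a + suc b
  top = trans (cong (s +_) (sym (+-suc a b))) (sym (+-assoc s a (suc b)))

-- The top element s + n must lie in ys, so it can be removed and the induction continues.
interval-prefix : ∀ s n xs ys → xs ≪ ys → xs ++ ys ↭ interval s n → xs ↭ interval s (length xs)
interval-prefix s n xs [] _ p =
  subst (λ m → xs ↭ interval s m) (sym (trans (Perm.↭-length p′) (length-interval s n))) p′
  where
  p′ : xs ↭ interval s n
  p′ = subst (_↭ _) (++-identityʳ xs) p
interval-prefix s zero xs (y ∷ ys) _ p with Perm.∈-resp-↭ p (∈-++⁺ʳ xs (here refl))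
... | ()
interval-prefix s (suc n) xs (y ∷ ys) xs≪ys p
  with ∈-++⁻ xs (Perm.∈-resp-↭ (↭-sym p) (interval-top s n))
... | inj₁ top∈xs = ⊥-elim (<⇒≱ (xs≪ys top∈xs (here refl))
                     (proj₂ (∈-interval⁻ (Perm.∈-resp-↭ p (∈-++⁺ʳ xs (here refl))))))
... | inj₂ top∈ys with ∈-∃++ top∈ys
...   | ys₁ , ys₂ , ys≡ = interval-prefix s n xs (ys₁ ++ ys₂) xs≪ys′ p′
  where
  p′ : xs ++ ys₁ ++ ys₂ ↭ interval s n
  p′ = subst₂ _↭_ (++-assoc xs ys₁ ys₂) (++-identityʳ _)
         (Perm.drop-mid (xs ++ ys₁) (interval s n)
           (subst₂ _↭_ (trans (cong (xs ++_) ys≡) (sym (++-assoc xs ys₁ _))) (interval-suc s n) p))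
  xs≪ys′ : xs ≪ (ys₁ ++ ys₂)
  xs≪ys′ u∈ w∈ with ∈-++⁻ ys₁ w∈
  ... | inj₁ w∈₁ = xs≪ys u∈ (subst (_ ∈_) (sym ys≡) (∈-++⁺ˡ w∈₁))
  ... | inj₂ w∈₂ = xs≪ys u∈ (subst (_ ∈_) (sym ys≡) (∈-++⁺ʳ ys₁ (there w∈₂)))

↭-++-cancelˡ : ∀ (xs : List ℕ) {ys zs} → xs ++ ys ↭ xs ++ zs → ys ↭ zs
↭-++-cancelˡ []       p = p
↭-++-cancelˡ (x ∷ xs) p = ↭-++-cancelˡ xs (Perm.drop-∷ p)

interval-split : ∀ {s a b} xs ys → xs ≪ ys → xs ++ ys ↭ interval s (a + b) → length xs ≡ a →
                 xs ↭ interval s a × ys ↭ interval (s + a) b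
interval-split {s} {a} {b} xs ys xs≪ys p refl = xs↭ , ys↭
  where
  xs↭ : xs ↭ interval s a
  xs↭ = interval-prefix s (a + b) xs ys xs≪ys p
  ys↭ : ys ↭ interval (s + a) b
  ys↭ = ↭-++-cancelˡ xs (↭-trans p (subst (_↭ xs ++ interval (s + a) b) (sym (interval-+ s a b))
          (Perm.++⁺ʳ (interval (s + a) b) (↭-sym xs↭))))

root≡top : ∀ {s l x r} → Decreasing (node l x r) →
           inorder (node l x r) ↭ interval s (size (node l x r)) → x ≡ s + size (node l x r)
root≡top {s} {l} {x} {r} d p = ≤-antisym x≤top top≤x
  where
  x≤top : x ≤ s + size (node l x r)
  x≤top = proj₂ (∈-interval⁻ (Perm.∈-resp-↭ p (∈-++⁺ʳ (inorder l) (here refl))))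
  top≤x : s + size (node l x r) ≤ x
  top≤x = s≤s⁻¹ (inorder-< (node l x r) d ≤-refl
                   (Perm.∈-resp-↭ (↭-sym p) (interval-top s _)))

children-intervals : ∀ {s l x r} → Decreasing (node l x r) → inorder l ≪ inorder r →
                     inorder (node l x r) ↭ interval s (size (node l x r)) →
                     inorder l ↭ interval s (size l) × inorder r ↭ interval (s + size l) (size r)
children-intervals {s} {l} {x} {r} d l≪r p =
  interval-split (inorder l) (inorder r) l≪r without-root (length-inorder l)
  where
  without-root : inorder l ++ inorder r ↭ interval s (size l + size r)
  without-root = subst (_ ↭_) (++-identityʳ _)
    (Perm.drop-mid (inorder l) (interval s (size l + size r))
      (subst₂ (λ y I → inorder l ++ y ∷ inorder r ↭ I) (root≡top d p) (interval-suc s _) p))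

splitAtVal-++ : ∀ v L R → (∀ {u} → u ∈ L → u ≢ v) → splitAtVal v (L ++ v ∷ R) ≡ (L , R)
splitAtVal-++ v [] R _ with v ≟ v
... | yes _  = refl
... | no v≢v = ⊥-elim (v≢v refl)
splitAtVal-++ v (y ∷ L) R fresh with y ≟ v
... | yes y≡v = ⊥-elim (fresh (here refl) y≡v)
... | no _ rewrite splitAtVal-++ v L R (fresh ∘ there) = refl

Pfuel-node : ∀ k L v R → length (L ++ v ∷ R) ≡ v → (∀ {u} → u ∈ L → u ≢ v) →
             Pfuel (suc k) (L ++ v ∷ R) ≡ (Pfuel k L ⊕ [ 1 ]) ⊖ Pfuel k (map (_∸ length L) R)
Pfuel-node k L v R len fresh = unfold L split
  where
  split : splitAtVal (length (L ++ v ∷ R)) (L ++ v ∷ R) ≡ (L , R)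
  split = subst (λ w → splitAtVal w (L ++ v ∷ R) ≡ (L , R)) (sym len)
                (splitAtVal-++ v L R fresh)
  unfold : ∀ L → splitAtVal (length (L ++ v ∷ R)) (L ++ v ∷ R) ≡ (L , R) →
           Pfuel (suc k) (L ++ v ∷ R) ≡ (Pfuel k L ⊕ [ 1 ]) ⊖ Pfuel k (map (_∸ length L) R)
  unfold []      eq rewrite eq = refl
  unfold (_ ∷ _) eq rewrite eq = refl

⊕1⊖-≡ : ∀ (A B : List ℕ) →
        (A ⊕ [ 1 ]) ⊖ B ≡ map (_+ length B) A ++ suc (length A + length B) ∷ B
⊕1⊖-≡ A B =
  trans (cong (_++ B) (map-++ (_+ length B) A _)) (++-assoc (map (_+ length B) A) _ B)

Pfuel-[] : ∀ k → Pfuel k [] ≡ []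
Pfuel-[] zero    = refl
Pfuel-[] (suc k) = refl

-- P(α ⊕ (1 ⊖ β)) = (P α ⊕ 1) ⊖ P β, read on the decreasing tree of α ⊕ (1 ⊖ β).
Ptree : Tree → Tree
Ptree leaf = leaf
Ptree (node l x r) = node (mapT (_+ size r) (Ptree l)) (size (node l x r)) (Ptree r)

SameShape-Ptree : ∀ T → SameShape (Ptree T) T
SameShape-Ptree leaf = leaf
SameShape-Ptree (node l x r) =
  node (SameShape-mapT _ (SameShape-Ptree l)) (SameShape-Ptree r)

RootBelow-Ptree : ∀ T {v} → size T < v → RootBelow v (Ptree T)
RootBelow-Ptree leaf _ = tt
RootBelow-Ptree (node _ _ _) size<v = size<v

Decreasing-Ptree : ∀ T → Decreasing (Ptree T)
Decreasing-Ptree leaf = tt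
Decreasing-Ptree (node l x r) =
  RootBelow-mapT (+-monoˡ-< (size r)) (Ptree l) (RootBelow-Ptree l ≤-refl) ,
  RootBelow-Ptree r (s≤s (m≤n+m (size r) (size l))) ,
  Decreasing-mapT (+-monoˡ-< (size r)) (Ptree l) (Decreasing-Ptree l) ,
  Decreasing-Ptree r

inorder-Ptree : ∀ l x r →
                inorder (Ptree (node l x r)) ≡ (inorder (Ptree l) ⊕ [ 1 ]) ⊖ inorder (Ptree r)
inorder-Ptree l x r = begin
  inorder (mapT (_+ size r) (Ptree l)) ++ suc (size l + size r) ∷ B
    ≡⟨ cong (_++ suc (size l + size r) ∷ B) (inorder-mapT (_+ size r) (Ptree l)) ⟩
  map (_+ size r) A ++ suc (size l + size r) ∷ B
    ≡⟨ cong₂ (λ a b → map (_+ b) A ++ suc (a + b) ∷ B)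
         (length-inorder-SameShape (SameShape-Ptree l))
         (length-inorder-SameShape (SameShape-Ptree r)) ⟨
  map (_+ length B) A ++ suc (length A + length B) ∷ B
    ≡⟨ ⊕1⊖-≡ A B ⟨
  (A ⊕ [ 1 ]) ⊖ B ∎
  where
  open ≡-Reasoning
  A = inorder (Ptree l)
  B = inorder (Ptree r)

-- The reading of a subtree is an interval [s+1 .. s+m], which P sees shifted down by s; the
-- shift by |α| that P applies to its right part then adds up to the offset s + |α| of r.
Pfuel-interval-node : ∀ k s {l x r} → Decreasing (node l x r) →
  inorder (node l x r) ↭ interval s (size (node l x r)) → inorder l ↭ interval s (size l) →
  Pfuel (suc k) (map (_∸ s) (inorder (node l x r))) ≡
  (Pfuel k (map (_∸ s) (inorder l)) ⊕ [ 1 ]) ⊖ Pfuel k (map (_∸ (s + size l)) (inorder r))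
Pfuel-interval-node k s {l} {x} {r} d@(rl , _ , dl , _) p pˡ = begin
  Pfuel (suc k) (map (_∸ s) (L ++ x ∷ R))
    ≡⟨ cong (Pfuel (suc k)) (map-++ (_∸ s) L (x ∷ R)) ⟩
  Pfuel (suc k) (L′ ++ x ∸ s ∷ R′)
    ≡⟨ Pfuel-node k L′ (x ∸ s) R′ length≡root fresh ⟩
  (Pfuel k L′ ⊕ [ 1 ]) ⊖ Pfuel k (map (_∸ length L′) R′)
    ≡⟨ cong (λ R″ → (Pfuel k L′ ⊕ [ 1 ]) ⊖ Pfuel k R″) shifts ⟩
  (Pfuel k L′ ⊕ [ 1 ]) ⊖ Pfuel k (map (_∸ (s + size l)) R) ∎
  where
  open ≡-Reasoning
  L = inorder l
  R = inorder r
  L′ = map (_∸ s) L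
  R′ = map (_∸ s) R
  length≡root : length (L′ ++ x ∸ s ∷ R′) ≡ x ∸ s
  length≡root = begin
    length (L′ ++ x ∸ s ∷ R′)         ≡⟨ cong length (map-++ (_∸ s) L (x ∷ R)) ⟨
    length (map (_∸ s) (L ++ x ∷ R))  ≡⟨ length-map _ (L ++ x ∷ R) ⟩
    length (L ++ x ∷ R)               ≡⟨ length-inorder (node l x r) ⟩
    size (node l x r)                 ≡⟨ m+n∸m≡n s _ ⟨
    s + size (node l x r) ∸ s         ≡⟨ cong (_∸ s) (root≡top d p) ⟨
    x ∸ s ∎
  fresh : ∀ {u} → u ∈ L′ → u ≢ x ∸ s
  fresh u∈ with ∈-map⁻ _ u∈
  ... | w , w∈ , refl = <⇒≢ (∸-monoˡ-< (inorder-< l dl rl w∈)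
                                        (<⇒≤ (proj₁ (∈-interval⁻ (Perm.∈-resp-↭ pˡ w∈)))))
  shifts : map (_∸ length L′) R′ ≡ map (_∸ (s + size l)) R
  shifts = trans (sym (map-∘ R)) (map-cong (λ v → trans (∸-+-assoc v s _)
             (cong (λ m → v ∸ (s + m)) (trans (length-map _ L) (length-inorder l)))) R)

Pfuel≡inorder-Ptree : ∀ k s T → size T ≤ k → Decreasing T → Separated T →
                      inorder T ↭ interval s (size T) →
                      Pfuel k (map (_∸ s) (inorder T)) ≡ inorder (Ptree T)
Pfuel≡inorder-Ptree k s leaf _ _ _ _ = Pfuel-[] k
Pfuel≡inorder-Ptree (suc k) s (node l x r) size≤ d@(_ , _ , dl , dr) (l≪r , sl , sr) p =
  begin
  Pfuel (suc k) (map (_∸ s) (inorder (node l x r)))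
    ≡⟨ Pfuel-interval-node k s d p pˡ ⟩
  (Pfuel k (map (_∸ s) (inorder l)) ⊕ [ 1 ]) ⊖ Pfuel k (map (_∸ (s + size l)) (inorder r))
    ≡⟨ cong₂ (λ A B → (A ⊕ [ 1 ]) ⊖ B)
         (Pfuel≡inorder-Ptree k s l (m+n≤o⇒m≤o (size l) sizes≤) dl sl pˡ)
         (Pfuel≡inorder-Ptree k (s + size l) r (m+n≤o⇒n≤o (size l) sizes≤) dr sr pʳ) ⟩
  (inorder (Ptree l) ⊕ [ 1 ]) ⊖ inorder (Ptree r)
    ≡⟨ inorder-Ptree l x r ⟨
  inorder (Ptree (node l x r)) ∎
  where
  open ≡-Reasoning
  sizes≤ : size l + size r ≤ k
  sizes≤ = s≤s⁻¹ size≤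
  pˡ : inorder l ↭ interval s (size l)
  pˡ = proj₁ (children-intervals d l≪r p)
  pʳ : inorder r ↭ interval (s + size l) (size r)
  pʳ = proj₂ (children-intervals d l≪r p)

P≡inorder-Ptree : ∀ {n} T → Decreasing T → Avoids231 (inorder T) → inorder T ↭ range n →
                  P (inorder T) ≡ inorder (Ptree T)
P≡inorder-Ptree {n} T d avoids p = begin
  Pfuel (length (inorder T)) (inorder T)
    ≡⟨ cong (Pfuel (length (inorder T))) (map-id (inorder T)) ⟨
  Pfuel (length (inorder T)) (map (_∸ 0) (inorder T))
    ≡⟨ Pfuel≡inorder-Ptree _ 0 T (≤-reflexive (sym (length-inorder T))) d separated p′ ⟩
  inorder (Ptree T) ∎
  where
  open ≡-Reasoning
  p₀ : inorder T ↭ interval 0 n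
  p₀ = subst (_ ↭_) (map-upTo suc n) p
  p′ : inorder T ↭ interval 0 (size T)
  p′ = subst (λ m → inorder T ↭ interval 0 m)
         (trans (sym (length-interval 0 n)) (trans (sym (Perm.↭-length p₀)) (length-inorder T))) p₀
  separated : Separated T
  separated = Avoids231⇒Separated T d
    (Permₛ.Unique-resp-↭ (setoid ℕ) (↭⇒↭ₛ (↭-sym p₀)) (Unique-interval 0 n)) avoids

mainTheorem9 : (n : ℕ) (π : List ℕ) → IsPerm n π → Avoids231 π →
    (λπ : List ℕ) → IsPerm n λπ → P π ≡ λπ ∘ₚ π →
    (T : Tree) → IsTin π T → IsTin (P π) (relabel λπ T)
mainTheorem9 n .(inorder T) perm avoids λπ _ P≡λπ∘π T (decreasing , refl) =
  subst Decreasing (sym relabel≡Ptree) (Decreasing-Ptree T) ,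
  trans (cong inorder relabel≡Ptree) (sym P≡Ptree)
  where
  P≡Ptree : P (inorder T) ≡ inorder (Ptree T)
  P≡Ptree = P≡inorder-Ptree T decreasing avoids perm
  relabel≡Ptree : relabel λπ T ≡ Ptree T
  relabel≡Ptree = trans (relabel≡mapT λπ T)
    (inorder-injective (SameShape-mapT _ (SameShape-refl T)) (SameShape-Ptree T)
      (trans (inorder-mapT (app λπ) T) (trans (sym P≡λπ∘π) P≡Ptree)))
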